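{- (i) For every $n\ge 3$, the star $K_{1,n}$ (one center adjacent to $n$ leaves) is the edge intersection hypergraph of a 3-uniform hypergraph. (ii) For $n=1$ and for every $n\ge 7$, the path $P_n$ with $n$ vertices is the edge intersection hypergraph of a 3-uniform hypergraph.
   Context: A hypergraph $\mathcal H=(V,\mathcal E)$ consists of a finite vertex set $V$ and a set $\mathcal E$ of subsets of $V$; it is 3-uniform if every hyperedge has exactly 3 elements. Its edge intersection hypergraph is $EI(\mathcal H)=(V,\mathcal E^{EI})$ with $\mathcal E^{EI}=\{e_1\cap e_2 \mid e_1,e_2\in\mathcal E,\ e_1\neq e_2,\ |e_1\cap e_2|\ge 2\}$. A graph $G$ is the edge intersection hypergraph of $\mathcal H$ if $\mathcal H$ has vertex set $V(G)$ and $\mathcal E^{EI}=E(G)$. -}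

module Defs where

open import Data.Nat using (ℕ; suc; _≤_)
open import Data.Fin using (Fin; zero; suc; toℕ)
open import Data.Fin.Subset using (Subset; _∩_; _∪_; ⁅_⁆; ∣_∣)
open import Data.List using (List)
open import Data.List.Relation.Unary.All using (All)
open import Data.List.Membership.Propositional using (_∈_)
open import Data.Product using (Σ; ∃; _×_)
open import Relation.Binary.PropositionalEquality using (_≡_; _≢_)
open import Function.Bundles using (_⇔_)

-- A hypergraph on vertex set Fin m, given by a (finite) list of hyperedges,
-- each hyperedge a subset of Fin m.  (Repetitions in the list are harmless:
-- the hyperedge *set* is the set of list members.)
record Hypergraph (m : ℕ) : Set where
  constructor hypergraph
  field
    hedges : List (Subset m)
open Hypergraph public

ThreeUniform : ∀ {m} → Hypergraph m → Set
ThreeUniform H = All (λ e → ∣ e ∣ ≡ 3) (hedges H)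

InEI : ∀ {m} → Hypergraph m → Subset m → Set
InEI {m} H S = Σ (Subset m) λ e₁ → Σ (Subset m) λ e₂ →
  e₁ ∈ hedges H × e₂ ∈ hedges H × e₁ ≢ e₂ × S ≡ e₁ ∩ e₂ × 2 ≤ ∣ e₁ ∩ e₂ ∣

-- A graph on Fin m is given by its edge predicate on 2-subsets of Fin m.
-- G is the edge intersection hypergraph of H:  E^EI(H) = E(G).
IsEdgeIntersectionOf : ∀ {m} → (Subset m → Set) → Hypergraph m → Set
IsEdgeIntersectionOf {m} isEdge H = (S : Subset m) → isEdge S ⇔ InEI H S

StarEdge : (n : ℕ) → Subset (suc n) → Set
StarEdge n S = ∃ λ (i : Fin n) → S ≡ ⁅ zero ⁆ ∪ ⁅ suc i ⁆

PathEdge : (n : ℕ) → Subset n → Set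
PathEdge n S = Σ (Fin n) λ i → Σ (Fin n) λ j → toℕ j ≡ suc (toℕ i) × S ≡ ⁅ i ⁆ ∪ ⁅ j ⁆

IsEI3 : ∀ {m} → (Subset m → Set) → Set
IsEI3 {m} isEdge = Σ (Hypergraph m) λ H → ThreeUniform H × IsEdgeIntersectionOf isEdge H

module Submission where

-- Two distinct 3-sets sharing two vertices x ≠ y meet in exactly {x, y}.  Hence a 3-uniform H
-- has EI(H) = G as soon as every edge of G lies in two distinct hyperedges and every pair of
-- vertices lying together in two distinct hyperedges is an edge of G.
-- For K_{1,n} (centre 0, leaves 1, …, n) take the n triangles {0, i, i+1} of the wheel with rim
-- 1, 2, …, n, 1: for n ≥ 3 they are distinct, and two leaves lie in at most one of them.
-- For P_n (vertices 0, …, n−1) take the windows {t, t+1, t+2} together with {0, 1, n−1} and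
-- {2, n−2, n−1}, which supply the two end edges; for n ≥ 7 the third vertex of each of these two
-- triples is at distance at least 3 from the other two, so it never shares a window with them.
-- P_1 has no edges and is the edge intersection hypergraph of the empty hypergraph.

open import Defs
open import Data.Empty using (⊥; ⊥-elim)
open import Data.Fin using (Fin; zero; suc; toℕ; fromℕ<)
open import Data.Fin.Properties using (toℕ-injective; toℕ-fromℕ<; toℕ<n; suc-injective)
open import Data.Fin.Subset
  using (Subset; _∩_; _∪_; ⁅_⁆; ∣_∣; _⊆_; Nonempty; outside; inside)
  renaming (_∈_ to _∈ˢ_)
open import Data.Fin.Subset.Properties
  using ( x∈p∪q⁺; x∈p∪q⁻; x∈⁅x⁆; x∈⁅y⁆⇒x≡y; ∣⁅x⁆∣≡1; x∈p∩q⁺; p∩q⊆p; p∩q⊆q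
        ; drop-∷-⊆; p⊆q⇒∣p∣≤∣q∣; x∈p⇒∣p-x∣<∣p∣; x∈p∧x≢y⇒x∈p-y
        ; nonempty?; Empty-unique; ∣⊥∣≡0; ∪-comm)
open import Data.List using (List; []; _∷_; map; upTo)
open import Data.List.Membership.Propositional using (_∈_)
open import Data.List.Membership.Propositional.Properties using (∈-map⁺; ∈-map⁻; ∈-upTo⁺; ∈-upTo⁻)
open import Data.List.Relation.Unary.Any using (here; there)
import Data.List.Relation.Unary.All as All
open import Data.Nat using (ℕ; zero; suc; _+_; _≤_; _<_; z≤n; s≤s; _≤?_)
open import Data.Nat.Properties
  using ( ≤-refl; ≤-trans; ≤-antisym; n≤1+n; m≤n+m; +-cancelˡ-≤; +-suc; +-monoʳ-≤; ≤-pred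
        ; ≰⇒>; 1+n≢n; <⇒≢; ≤⇒≯; m≤n⇒m<n∨m≡n; module ≤-Reasoning)
  renaming (_≟_ to _≟ℕ_)
open import Data.Product using (∃₂; _×_; _,_; proj₁; proj₂)
open import Data.Sum using (_⊎_; inj₁; inj₂)
open import Data.Vec using ([]; _∷_; tabulate; here; there)
open import Data.Vec.Properties using (lookup∘tabulate; []=⇒lookup; lookup⇒[]=)
open import Function using (_∘_)
open import Function.Bundles using (mk⇔)
open import Relation.Nullary using (Dec; does; proof; Reflects; invert; yes; no; ¬_; contradiction)
open import Relation.Nullary.Decidable using (_⊎-dec_; dec-true)
open import Relation.Binary.PropositionalEquality using (_≡_; _≢_; refl; sym; trans; cong; cong₂; subst)

private
  variable
    n : ℕ
    p q : Subset n
    x y z : Fin n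
    t u w : ℕ

∣p∪q∣≤∣p∣+∣q∣ : (p q : Subset n) → ∣ p ∪ q ∣ ≤ ∣ p ∣ + ∣ q ∣
∣p∪q∣≤∣p∣+∣q∣ []            []            = z≤n
∣p∪q∣≤∣p∣+∣q∣ (outside ∷ p) (outside ∷ q) = ∣p∪q∣≤∣p∣+∣q∣ p q
∣p∪q∣≤∣p∣+∣q∣ (outside ∷ p) (inside  ∷ q) rewrite +-suc ∣ p ∣ ∣ q ∣ = s≤s (∣p∪q∣≤∣p∣+∣q∣ p q)
∣p∪q∣≤∣p∣+∣q∣ (inside  ∷ p) (outside ∷ q) = s≤s (∣p∪q∣≤∣p∣+∣q∣ p q)
∣p∪q∣≤∣p∣+∣q∣ (inside  ∷ p) (inside  ∷ q) =
  s≤s (≤-trans (∣p∪q∣≤∣p∣+∣q∣ p q) (+-monoʳ-≤ ∣ p ∣ (n≤1+n ∣ q ∣)))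

p⊆q∧∣q∣≤∣p∣⇒p≡q : p ⊆ q → ∣ q ∣ ≤ ∣ p ∣ → p ≡ q
p⊆q∧∣q∣≤∣p∣⇒p≡q {p = []}          {[]}          _   _ = refl
p⊆q∧∣q∣≤∣p∣⇒p≡q {p = outside ∷ p} {outside ∷ q} p⊆q ∣q∣≤∣p∣ =
  cong (outside ∷_) (p⊆q∧∣q∣≤∣p∣⇒p≡q (drop-∷-⊆ p⊆q) ∣q∣≤∣p∣)
p⊆q∧∣q∣≤∣p∣⇒p≡q {p = outside ∷ p} {inside  ∷ q} p⊆q ∣q∣<∣p∣ =
  contradiction ∣q∣<∣p∣ (≤⇒≯ (p⊆q⇒∣p∣≤∣q∣ (drop-∷-⊆ p⊆q)))
p⊆q∧∣q∣≤∣p∣⇒p≡q {p = inside  ∷ p} {outside ∷ q} p⊆q _ = contradiction (p⊆q here) λ ()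
p⊆q∧∣q∣≤∣p∣⇒p≡q {p = inside  ∷ p} {inside  ∷ q} p⊆q ∣q∣≤∣p∣ =
  cong (inside ∷_) (p⊆q∧∣q∣≤∣p∣⇒p≡q (drop-∷-⊆ p⊆q) (≤-pred ∣q∣≤∣p∣))

x∈p⇒1≤∣p∣ : x ∈ˢ p → 1 ≤ ∣ p ∣
x∈p⇒1≤∣p∣ x∈p = ≤-trans (s≤s z≤n) (x∈p⇒∣p-x∣<∣p∣ x∈p)

x∈p∧y∈p∧x≢y⇒2≤∣p∣ : x ∈ˢ p → y ∈ˢ p → x ≢ y → 2 ≤ ∣ p ∣
x∈p∧y∈p∧x≢y⇒2≤∣p∣ x∈p y∈p x≢y =
  ≤-trans (s≤s (x∈p⇒1≤∣p∣ (x∈p∧x≢y⇒x∈p-y y∈p (x≢y ∘ sym)))) (x∈p⇒∣p-x∣<∣p∣ x∈p)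

x∈p∧y∈p∧z∈p⇒3≤∣p∣ : x ∈ˢ p → y ∈ˢ p → z ∈ˢ p → x ≢ y → x ≢ z → y ≢ z → 3 ≤ ∣ p ∣
x∈p∧y∈p∧z∈p⇒3≤∣p∣ x∈p y∈p z∈p x≢y x≢z y≢z =
  ≤-trans (s≤s (x∈p∧y∈p∧x≢y⇒2≤∣p∣ (x∈p∧x≢y⇒x∈p-y y∈p (x≢y ∘ sym)) (x∈p∧x≢y⇒x∈p-y z∈p (x≢z ∘ sym)) y≢z))
          (x∈p⇒∣p-x∣<∣p∣ x∈p)

1≤∣p∣⇒Nonempty : 1 ≤ ∣ p ∣ → Nonempty p
1≤∣p∣⇒Nonempty {n} {p} 1≤∣p∣ with nonempty? p
... | yes p≢∅ = p≢∅
... | no  p≡∅ with () ← subst (1 ≤_) (trans (cong ∣_∣ (Empty-unique p≡∅)) (∣⊥∣≡0 n)) 1≤∣p∣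

2≤∣p∣⇒distinct∈ : 2 ≤ ∣ p ∣ → ∃₂ λ x y → x ≢ y × x ∈ˢ p × y ∈ˢ p
2≤∣p∣⇒distinct∈ {p = inside ∷ p} (s≤s 1≤∣p∣) with y , y∈p ← 1≤∣p∣⇒Nonempty 1≤∣p∣ =
  zero , suc y , (λ ()) , here , there y∈p
2≤∣p∣⇒distinct∈ {p = outside ∷ p} 2≤∣p∣ with x , y , x≢y , x∈p , y∈p ← 2≤∣p∣⇒distinct∈ 2≤∣p∣ =
  suc x , suc y , x≢y ∘ suc-injective , there x∈p , there y∈p

∣p∣≡∣q∣∧p≢q⇒∣p∩q∣<∣p∣ : ∣ p ∣ ≡ ∣ q ∣ → p ≢ q → ∣ p ∩ q ∣ < ∣ p ∣
∣p∣≡∣q∣∧p≢q⇒∣p∩q∣<∣p∣ {p = p} {q} ∣p∣≡∣q∣ p≢q with ∣ p ∣ ≤? ∣ p ∩ q ∣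
... | no  ∣p∣≰∣p∩q∣ = ≰⇒> ∣p∣≰∣p∩q∣
... | yes ∣p∣≤∣p∩q∣ = contradiction p≡q p≢q
  where
  p∩q≡p : p ∩ q ≡ p
  p∩q≡p = p⊆q∧∣q∣≤∣p∣⇒p≡q (p∩q⊆p p q) ∣p∣≤∣p∩q∣
  p⊆q : p ⊆ q
  p⊆q x∈p = p∩q⊆q p q (subst (_ ∈ˢ_) (sym p∩q≡p) x∈p)
  p≡q : p ≡ q
  p≡q = p⊆q∧∣q∣≤∣p∣⇒p≡q p⊆q (subst (_≤ ∣ p ∣) ∣p∣≡∣q∣ ≤-refl)

p∩q≡⁅x⁆∪⁅y⁆ : ∣ p ∣ ≡ 3 → ∣ q ∣ ≡ 3 → p ≢ q → x ≢ y → x ∈ˢ p ∩ q → y ∈ˢ p ∩ q → p ∩ q ≡ ⁅ x ⁆ ∪ ⁅ y ⁆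
p∩q≡⁅x⁆∪⁅y⁆ {p = p} {q} {x} {y} ∣p∣≡3 ∣q∣≡3 p≢q x≢y x∈p∩q y∈p∩q =
  sym (p⊆q∧∣q∣≤∣p∣⇒p≡q pair⊆p∩q (≤-trans ∣p∩q∣≤2 2≤∣pair∣))
  where
  pair⊆p∩q : ⁅ x ⁆ ∪ ⁅ y ⁆ ⊆ p ∩ q
  pair⊆p∩q z∈pair with x∈p∪q⁻ ⁅ x ⁆ ⁅ y ⁆ z∈pair
  ... | inj₁ z∈⁅x⁆ rewrite x∈⁅y⁆⇒x≡y x z∈⁅x⁆ = x∈p∩q
  ... | inj₂ z∈⁅y⁆ rewrite x∈⁅y⁆⇒x≡y y z∈⁅y⁆ = y∈p∩q
  ∣p∩q∣≤2 : ∣ p ∩ q ∣ ≤ 2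
  ∣p∩q∣≤2 = ≤-pred (subst (∣ p ∩ q ∣ <_) ∣p∣≡3 (∣p∣≡∣q∣∧p≢q⇒∣p∩q∣<∣p∣ (trans ∣p∣≡3 (sym ∣q∣≡3)) p≢q))
  2≤∣pair∣ : 2 ≤ ∣ ⁅ x ⁆ ∪ ⁅ y ⁆ ∣
  2≤∣pair∣ = x∈p∧y∈p∧x≢y⇒2≤∣p∣ (x∈p∪q⁺ (inj₁ (x∈⁅x⁆ x))) (x∈p∪q⁺ (inj₂ (x∈⁅x⁆ y))) x≢y

record SharedPair {n} (H : Hypergraph n) (x y : Fin n) : Set where
  constructor shared
  field
    {e₁ e₂}   : Subset n
    e₁∈H      : e₁ ∈ hedges H
    e₂∈H      : e₂ ∈ hedges H
    e₁≢e₂     : e₁ ≢ e₂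
    x∈e₁∩e₂   : x ∈ˢ e₁ ∩ e₂
    y∈e₁∩e₂   : y ∈ˢ e₁ ∩ e₂

isEdgeIntersectionOf : {H : Hypergraph n} {isEdge : Subset n → Set} → ThreeUniform H →
  (∀ {S} → isEdge S → ∃₂ λ x y → x ≢ y × S ≡ ⁅ x ⁆ ∪ ⁅ y ⁆ × SharedPair H x y) →
  (∀ {x y} → x ≢ y → SharedPair H x y → isEdge (⁅ x ⁆ ∪ ⁅ y ⁆)) →
  IsEdgeIntersectionOf isEdge H
isEdgeIntersectionOf {H = H} {isEdge} uniform edge⇒shared shared⇒edge S = mk⇔ edge⇒EI EI⇒edge
  where
  intersection : ∀ {x y} → x ≢ y → (s : SharedPair H x y) →
                 let open SharedPair s in e₁ ∩ e₂ ≡ ⁅ x ⁆ ∪ ⁅ y ⁆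
  intersection x≢y (shared e₁∈H e₂∈H e₁≢e₂ x∈ y∈) =
    p∩q≡⁅x⁆∪⁅y⁆ (All.lookup uniform e₁∈H) (All.lookup uniform e₂∈H) e₁≢e₂ x≢y x∈ y∈
  edge⇒EI : isEdge S → InEI H S
  edge⇒EI S-edge with x , y , x≢y , refl , s@(shared {e₁} {e₂} e₁∈H e₂∈H e₁≢e₂ x∈ y∈) ← edge⇒shared S-edge =
    e₁ , e₂ , e₁∈H , e₂∈H , e₁≢e₂ , sym (intersection x≢y s) ,
    x∈p∧y∈p∧x≢y⇒2≤∣p∣ x∈ y∈ x≢y
  EI⇒edge : InEI H S → isEdge S
  EI⇒edge (e₁ , e₂ , e₁∈H , e₂∈H , e₁≢e₂ , refl , 2≤∣e₁∩e₂∣)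
    with x , y , x≢y , x∈ , y∈ ← 2≤∣p∣⇒distinct∈ 2≤∣e₁∩e₂∣ =
    subst isEdge (sym (intersection x≢y s)) (shared⇒edge x≢y s)
    where s = shared e₁∈H e₂∈H e₁≢e₂ x∈ y∈

OneOf : ℕ → ℕ → ℕ → ℕ → Set
OneOf u a b c = u ≡ a ⊎ u ≡ b ⊎ u ≡ c

oneOf? : ∀ u a b c → Dec (OneOf u a b c)
oneOf? u a b c = u ≟ℕ a ⊎-dec u ≟ℕ b ⊎-dec u ≟ℕ c

-- The vertices of Fin n with values a, b, c; values ≥ n are silently dropped.  Opaque, so that
-- unification can read the values off a triple.
opaque
  triple : ℕ → ℕ → ℕ → Subset n
  triple a b c = tabulate λ x → does (oneOf? (toℕ x) a b c)

  ∈-triple⁺ : ∀ {a b c} → OneOf (toℕ x) a b c → x ∈ˢ triple a b c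
  ∈-triple⁺ {x = x} {a} {b} {c} x∈abc =
    lookup⇒[]= x _ (trans (lookup∘tabulate _ x) (dec-true (oneOf? (toℕ x) a b c) x∈abc))

  ∈-triple⁻ : ∀ {a b c} → x ∈ˢ triple a b c → OneOf (toℕ x) a b c
  ∈-triple⁻ {x = x} {a} {b} {c} x∈t =
    invert (subst (Reflects _) (trans (sym (lookup∘tabulate _ x)) ([]=⇒lookup x∈t))
                  (proof (oneOf? (toℕ x) a b c)))

module _ {a b c : ℕ} where

  vertex∈triple : ∀ {v} (v<n : v < n) → OneOf v a b c → fromℕ< v<n ∈ˢ triple a b c
  vertex∈triple v<n v∈abc = ∈-triple⁺ (subst (λ u → OneOf u a b c) (sym (toℕ-fromℕ< v<n)) v∈abc)

  ∣triple∣≡3 : a < b → b < c → c < n → ∣ triple {n} a b c ∣ ≡ 3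
  ∣triple∣≡3 {n} a<b b<c c<n = ≤-antisym ∣triple∣≤3 3≤∣triple∣
    where
    b<n = ≤-trans b<c (≤-trans (n≤1+n c) c<n)
    a<n = ≤-trans a<b (≤-trans (n≤1+n b) b<n)
    a′ = fromℕ< a<n
    b′ = fromℕ< b<n
    c′ = fromℕ< c<n
    separate : ∀ {u v} (u<n : u < n) (v<n : v < n) → u < v → fromℕ< u<n ≢ fromℕ< v<n
    separate u<n v<n u<v eq =
      <⇒≢ u<v (trans (sym (toℕ-fromℕ< u<n)) (trans (cong toℕ eq) (toℕ-fromℕ< v<n)))
    3≤∣triple∣ : 3 ≤ ∣ triple {n} a b c ∣
    3≤∣triple∣ = x∈p∧y∈p∧z∈p⇒3≤∣p∣
      (vertex∈triple a<n (inj₁ refl)) (vertex∈triple b<n (inj₂ (inj₁ refl)))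
      (vertex∈triple c<n (inj₂ (inj₂ refl)))
      (separate a<n b<n a<b) (separate a<n c<n (≤-trans a<b (≤-trans (n≤1+n b) b<c)))
      (separate b<n c<n b<c)
    is : ∀ {x v} (v<n : v < n) → toℕ x ≡ v → x ∈ˢ ⁅ fromℕ< v<n ⁆
    is {x} v<n refl = subst (_∈ˢ ⁅ fromℕ< v<n ⁆) (toℕ-injective (toℕ-fromℕ< v<n)) (x∈⁅x⁆ _)
    triple⊆ : triple a b c ⊆ ⁅ a′ ⁆ ∪ ⁅ b′ ⁆ ∪ ⁅ c′ ⁆
    triple⊆ x∈t with ∈-triple⁻ x∈t
    ... | inj₁ x≡a        = x∈p∪q⁺ (inj₁ (is a<n x≡a))
    ... | inj₂ (inj₁ x≡b) = x∈p∪q⁺ (inj₂ (x∈p∪q⁺ (inj₁ (is b<n x≡b))))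
    ... | inj₂ (inj₂ x≡c) = x∈p∪q⁺ (inj₂ (x∈p∪q⁺ (inj₂ (is c<n x≡c))))
    ∣triple∣≤3 : ∣ triple {n} a b c ∣ ≤ 3
    ∣triple∣≤3 = begin
      ∣ triple {n} a b c ∣                       ≤⟨ p⊆q⇒∣p∣≤∣q∣ triple⊆ ⟩
      ∣ ⁅ a′ ⁆ ∪ ⁅ b′ ⁆ ∪ ⁅ c′ ⁆ ∣               ≤⟨ ∣p∪q∣≤∣p∣+∣q∣ ⁅ a′ ⁆ _ ⟩
      ∣ ⁅ a′ ⁆ ∣ + ∣ ⁅ b′ ⁆ ∪ ⁅ c′ ⁆ ∣           ≤⟨ +-monoʳ-≤ ∣ ⁅ a′ ⁆ ∣ (∣p∪q∣≤∣p∣+∣q∣ ⁅ b′ ⁆ _) ⟩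
      ∣ ⁅ a′ ⁆ ∣ + (∣ ⁅ b′ ⁆ ∣ + ∣ ⁅ c′ ⁆ ∣)
        ≡⟨ cong₂ _+_ (∣⁅x⁆∣≡1 a′) (cong₂ _+_ (∣⁅x⁆∣≡1 b′) (∣⁅x⁆∣≡1 c′)) ⟩
      3                                          ∎
      where open ≤-Reasoning

triple≢ : ∀ {a b c a′ b′ c′ v} → v < n → OneOf v a b c → ¬ OneOf v a′ b′ c′ →
          triple {n} a b c ≢ triple a′ b′ c′
triple≢ v<n v∈abc v∉abc′ eq = v∉abc′ (subst (λ u → OneOf u _ _ _) (toℕ-fromℕ< v<n)
  (∈-triple⁻ (subst (fromℕ< v<n ∈ˢ_) eq (vertex∈triple v<n v∈abc))))

OneOf-rotate : ∀ {a b c} → OneOf u a b c → OneOf u b c a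
OneOf-rotate (inj₁ u≡a)        = inj₂ (inj₂ u≡a)
OneOf-rotate (inj₂ (inj₁ u≡b)) = inj₁ u≡b
OneOf-rotate (inj₂ (inj₂ u≡c)) = inj₂ (inj₁ u≡c)

∈ˡ-triple⁻ : ∀ {a b c} → x ∈ˢ triple a b c ∩ q → OneOf (toℕ x) a b c
∈ˡ-triple⁻ {q = q} x∈ = ∈-triple⁻ (p∩q⊆p (triple _ _ _) q x∈)

∈ʳ-triple⁻ : ∀ {a b c} → x ∈ˢ p ∩ triple a b c → OneOf (toℕ x) a b c
∈ʳ-triple⁻ {p = p} x∈ = ∈-triple⁻ (p∩q⊆q p (triple _ _ _) x∈)

sharedByTriples : ∀ {H : Hypergraph n} {u w a b c a′ b′ c′} →
  triple a b c ∈ hedges H → triple a′ b′ c′ ∈ hedges H → triple {n} a b c ≢ triple a′ b′ c′ →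
  toℕ x ≡ u → toℕ y ≡ w → OneOf u a b c → OneOf u a′ b′ c′ → OneOf w a b c → OneOf w a′ b′ c′ →
  SharedPair H x y
sharedByTriples e₁∈H e₂∈H e₁≢e₂ refl refl u∈e₁ u∈e₂ w∈e₁ w∈e₂ =
  shared e₁∈H e₂∈H e₁≢e₂
    (x∈p∩q⁺ (∈-triple⁺ u∈e₁ , ∈-triple⁺ u∈e₂)) (x∈p∩q⁺ (∈-triple⁺ w∈e₁ , ∈-triple⁺ w∈e₂))

unorderedPair-unique : ∀ {A : Set} {u w a b c d : A} → u ≢ w →
  u ≡ a ⊎ u ≡ b → w ≡ a ⊎ w ≡ b → u ≡ c ⊎ u ≡ d → w ≡ c ⊎ w ≡ d → (a ≡ c × b ≡ d) ⊎ (a ≡ d × b ≡ c)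
unorderedPair-unique u≢w (inj₁ refl) (inj₁ refl) _          _          = contradiction refl u≢w
unorderedPair-unique u≢w (inj₂ refl) (inj₂ refl) _          _          = contradiction refl u≢w
unorderedPair-unique u≢w _           _           (inj₁ refl) (inj₁ refl) = contradiction refl u≢w
unorderedPair-unique u≢w _           _           (inj₂ refl) (inj₂ refl) = contradiction refl u≢w
unorderedPair-unique _   (inj₁ refl) (inj₂ refl) (inj₁ refl) (inj₂ refl) = inj₁ (refl , refl)
unorderedPair-unique _   (inj₁ refl) (inj₂ refl) (inj₂ refl) (inj₁ refl) = inj₂ (refl , refl)
unorderedPair-unique _   (inj₂ refl) (inj₁ refl) (inj₁ refl) (inj₂ refl) = inj₂ (refl , refl)
unorderedPair-unique _   (inj₂ refl) (inj₁ refl) (inj₂ refl) (inj₁ refl) = inj₁ (refl , refl)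

module Star (k : ℕ) where

  rimTriangle : ℕ → Subset (4 + k)
  rimTriangle t = triple 0 (1 + t) (2 + t)

  closingTriangle : Subset (4 + k)
  closingTriangle = triple 0 1 (3 + k)

  triangles : List (Subset (4 + k))
  triangles = closingTriangle ∷ map rimTriangle (upTo (2 + k))

  wheel : Hypergraph (4 + k)
  wheel = hypergraph triangles

  data Triangle : ℕ → ℕ → Subset (4 + k) → Set where
    closing : Triangle 1 (3 + k) closingTriangle
    rim     : ∀ {t} → t < 2 + k → Triangle (1 + t) (2 + t) (rimTriangle t)

  triangle : ∀ {e} → e ∈ triangles → ∃₂ λ a b → Triangle a b e
  triangle (here refl) = _ , _ , closing
  triangle (there e∈) with t , t∈ , refl ← ∈-map⁻ rimTriangle e∈ = _ , _ , rim (∈-upTo⁻ t∈)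

  closing∈ : closingTriangle ∈ triangles
  closing∈ = here refl

  rim∈ : ∀ {t} → t < 2 + k → rimTriangle t ∈ triangles
  rim∈ t<2+k = there (∈-map⁺ rimTriangle (∈-upTo⁺ t<2+k))

  uniform : ThreeUniform wheel
  uniform = All.tabulate λ e∈ → let _ , _ , t = triangle e∈ in ∣Triangle∣≡3 t
    where
    ∣Triangle∣≡3 : ∀ {a b e} → Triangle a b e → ∣ e ∣ ≡ 3
    ∣Triangle∣≡3 closing       = ∣triple∣≡3 (s≤s z≤n) (s≤s (s≤s z≤n)) ≤-refl
    ∣Triangle∣≡3 (rim t<2+k)   = ∣triple∣≡3 (s≤s z≤n) ≤-refl (s≤s (s≤s t<2+k))

  leaf∈Triangle : ∀ {a b e} {i : Fin (3 + k)} → Triangle a b e → suc i ∈ˢ e →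
                  suc (toℕ i) ≡ a ⊎ suc (toℕ i) ≡ b
  leaf∈Triangle closing  i∈e with inj₂ i∈ab ← ∈-triple⁻ i∈e = i∈ab
  leaf∈Triangle (rim _) i∈e with inj₂ i∈ab ← ∈-triple⁻ i∈e = i∈ab

  rimPair-injective : ∀ {a b c d e₁ e₂} → Triangle a b e₁ → Triangle c d e₂ →
                      (a ≡ c × b ≡ d) ⊎ (a ≡ d × b ≡ c) → e₁ ≡ e₂
  rimPair-injective closing closing _                      = refl
  rimPair-injective (rim _) (rim _) (inj₁ (refl , _))      = refl
  rimPair-injective (rim _) (rim _) (inj₂ (refl , ()))
  rimPair-injective closing (rim _) (inj₁ (refl , ()))
  rimPair-injective closing (rim _) (inj₂ (() , _))
  rimPair-injective (rim _) closing (inj₁ (refl , ()))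
  rimPair-injective (rim _) closing (inj₂ (refl , ()))

  noSharedLeaves : ∀ {i j} → i ≢ j → ¬ SharedPair wheel (suc i) (suc j)
  noSharedLeaves i≢j (shared {e₁} {e₂} e₁∈ e₂∈ e₁≢e₂ i∈ j∈)
    with _ , _ , t₁ ← triangle e₁∈ | _ , _ , t₂ ← triangle e₂∈ =
    e₁≢e₂ (rimPair-injective t₁ t₂ (unorderedPair-unique (i≢j ∘ suc-injective ∘ toℕ-injective)
      (leaf∈Triangle t₁ (p∩q⊆p e₁ e₂ i∈)) (leaf∈Triangle t₁ (p∩q⊆p e₁ e₂ j∈))
      (leaf∈Triangle t₂ (p∩q⊆q e₁ e₂ i∈)) (leaf∈Triangle t₂ (p∩q⊆q e₁ e₂ j∈))))

  closing≢firstRim : closingTriangle ≢ rimTriangle 0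
  closing≢firstRim = triple≢ ≤-refl (inj₂ (inj₂ refl)) λ { (inj₁ ()) ; (inj₂ (inj₁ ())) ; (inj₂ (inj₂ ())) }

  rim≢nextRim : ∀ {t} → t < 2 + k → rimTriangle t ≢ rimTriangle (1 + t)
  rim≢nextRim t<2+k =
    triple≢ (s≤s (≤-trans t<2+k (n≤1+n _))) (inj₂ (inj₁ refl)) λ { (inj₁ ()) ; (inj₂ (inj₁ ())) ; (inj₂ (inj₂ ())) }

  lastRim≢closing : rimTriangle (1 + k) ≢ closingTriangle
  lastRim≢closing = triple≢ (n≤1+n _) (inj₂ (inj₁ refl)) λ { (inj₁ ()) ; (inj₂ (inj₁ ())) ; (inj₂ (inj₂ ())) }

  spokeShared : ∀ {i : Fin (3 + k)} ℓ → toℕ i ≡ ℓ → ℓ < 3 + k → SharedPair wheel zero (suc i)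
  spokeShared zero i≡ℓ _ =
    sharedByTriples closing∈ (rim∈ (s≤s z≤n)) closing≢firstRim
      refl (cong suc i≡ℓ) (inj₁ refl) (inj₁ refl) (inj₂ (inj₁ refl)) (inj₂ (inj₁ refl))
  spokeShared (suc t) i≡ℓ (s≤s t<2+k) with m≤n⇒m<n∨m≡n t<2+k
  ... | inj₁ 1+t<2+k =
    sharedByTriples (rim∈ t<2+k) (rim∈ 1+t<2+k) (rim≢nextRim t<2+k)
      refl (cong suc i≡ℓ) (inj₁ refl) (inj₁ refl) (inj₂ (inj₂ refl)) (inj₂ (inj₁ refl))
  ... | inj₂ refl =
    sharedByTriples (rim∈ ≤-refl) closing∈ lastRim≢closing
      refl (cong suc i≡ℓ) (inj₁ refl) (inj₁ refl) (inj₂ (inj₂ refl)) (inj₂ (inj₂ refl))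

  isEI3 : IsEI3 (StarEdge (3 + k))
  isEI3 = wheel , uniform , isEdgeIntersectionOf uniform edge⇒shared shared⇒edge
    where
    edge⇒shared : ∀ {S} → StarEdge (3 + k) S → ∃₂ λ x y → x ≢ y × S ≡ ⁅ x ⁆ ∪ ⁅ y ⁆ × SharedPair wheel x y
    edge⇒shared (i , refl) = zero , suc i , (λ ()) , refl , spokeShared (toℕ i) refl (toℕ<n i)
    shared⇒edge : ∀ {x y} → x ≢ y → SharedPair wheel x y → StarEdge (3 + k) (⁅ x ⁆ ∪ ⁅ y ⁆)
    shared⇒edge {zero}  {zero}  x≢y _ = contradiction refl x≢y
    shared⇒edge {zero}  {suc j} _   _ = j , refl
    shared⇒edge {suc i} {zero}  _   _ = i , ∪-comm ⁅ suc i ⁆ ⁅ zero ⁆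
    shared⇒edge {suc i} {suc j} x≢y s = contradiction s (noSharedLeaves (x≢y ∘ cong suc))

Window : ℕ → ℕ → Set
Window t u = OneOf u t (1 + t) (2 + t)

Consecutive : ℕ → ℕ → Set
Consecutive u w = w ≡ suc u ⊎ u ≡ suc w

consecutive⇒PathEdge : Consecutive (toℕ x) (toℕ y) → PathEdge n (⁅ x ⁆ ∪ ⁅ y ⁆)
consecutive⇒PathEdge {x = x} {y} (inj₁ y≡1+x) = x , y , y≡1+x , refl
consecutive⇒PathEdge {x = x} {y} (inj₂ x≡1+y) = y , x , x≡1+y , ∪-comm ⁅ x ⁆ ⁅ y ⁆

window-bounds : Window t u → t ≤ u × u ≤ 2 + t
window-bounds {t} (inj₁ refl)        = ≤-refl , m≤n+m t 2
window-bounds {t} (inj₂ (inj₁ refl)) = n≤1+n t , n≤1+n (1 + t)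
window-bounds {t} (inj₂ (inj₂ refl)) = m≤n+m t 2 , ≤-refl

window-spread : Window t u → Window t w → w ≤ 2 + u
window-spread u∈t w∈t = ≤-trans (proj₂ (window-bounds w∈t)) (+-monoʳ-≤ 2 (proj₁ (window-bounds u∈t)))

¬window-far : 3 + u ≤ w → Window t u → Window t w → ⊥
¬window-far 3+u≤w u∈t w∈t = ≤⇒≯ (window-spread u∈t w∈t) 3+u≤w

window-pair : Window t u → Window t w → u ≢ w →
              Consecutive u w ⊎ (u ≡ t × w ≡ 2 + t) ⊎ (w ≡ t × u ≡ 2 + t)
window-pair (inj₁ refl)        (inj₁ refl)        u≢w = contradiction refl u≢w
window-pair (inj₁ refl)        (inj₂ (inj₁ refl)) _   = inj₁ (inj₁ refl)
window-pair (inj₁ refl)        (inj₂ (inj₂ refl)) _   = inj₂ (inj₁ (refl , refl))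
window-pair (inj₂ (inj₁ refl)) (inj₁ refl)        _   = inj₁ (inj₂ refl)
window-pair (inj₂ (inj₁ refl)) (inj₂ (inj₁ refl)) u≢w = contradiction refl u≢w
window-pair (inj₂ (inj₁ refl)) (inj₂ (inj₂ refl)) _   = inj₁ (inj₁ refl)
window-pair (inj₂ (inj₂ refl)) (inj₁ refl)        _   = inj₂ (inj₂ (refl , refl))
window-pair (inj₂ (inj₂ refl)) (inj₂ (inj₁ refl)) _   = inj₁ (inj₂ refl)
window-pair (inj₂ (inj₂ refl)) (inj₂ (inj₂ refl)) u≢w = contradiction refl u≢w

window-ends : ∀ {s t} → Window s t → Window s (2 + t) → s ≡ t
window-ends {s} {t} t∈s 2+t∈s =
  ≤-antisym (proj₁ (window-bounds t∈s)) (+-cancelˡ-≤ 2 t s (proj₂ (window-bounds 2+t∈s)))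

windows-consecutive : ∀ {s t u w} → s ≢ t → Window s u → Window s w → Window t u → Window t w → u ≢ w →
                      Consecutive u w
windows-consecutive s≢t u∈s w∈s u∈t w∈t u≢w with window-pair u∈s w∈s u≢w
... | inj₁ consecutive            = consecutive
... | inj₂ (inj₁ (refl , refl)) = contradiction (sym (window-ends u∈t w∈t)) s≢t
... | inj₂ (inj₂ (refl , refl)) = contradiction (sym (window-ends w∈t u∈t)) s≢t

¬window-nearFar : ∀ {a c t v} → 4 + a ≤ c ⊎ 3 + c ≤ a → v ≡ a ⊎ v ≡ 1 + a → Window t v → Window t c → ⊥
¬window-nearFar (inj₁ 4+a≤c) (inj₁ refl) v∈t c∈t = ¬window-far (≤-trans (n≤1+n _) 4+a≤c) v∈t c∈t
¬window-nearFar (inj₁ 4+a≤c) (inj₂ refl) v∈t c∈t = ¬window-far 4+a≤c v∈t c∈t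
¬window-nearFar (inj₂ 3+c≤a) (inj₁ refl) v∈t c∈t = ¬window-far 3+c≤a c∈t v∈t
¬window-nearFar (inj₂ 3+c≤a) (inj₂ refl) v∈t c∈t = ¬window-far (≤-trans 3+c≤a (n≤1+n _)) c∈t v∈t

nearPair-window : ∀ {a c t u w} → 4 + a ≤ c ⊎ 3 + c ≤ a → u ≢ w →
  OneOf u a (1 + a) c → OneOf w a (1 + a) c → Window t u → Window t w → Consecutive u w
nearPair-window far u≢w (inj₁ refl)        (inj₁ refl)        _   _   = contradiction refl u≢w
nearPair-window far u≢w (inj₂ (inj₁ refl)) (inj₂ (inj₁ refl)) _   _   = contradiction refl u≢w
nearPair-window far u≢w (inj₂ (inj₂ refl)) (inj₂ (inj₂ refl)) _   _   = contradiction refl u≢w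
nearPair-window far _   (inj₁ refl)        (inj₂ (inj₁ refl)) _   _   = inj₁ refl
nearPair-window far _   (inj₂ (inj₁ refl)) (inj₁ refl)        _   _   = inj₂ refl
nearPair-window far _   (inj₁ refl)        (inj₂ (inj₂ refl)) u∈t w∈t =
  ⊥-elim (¬window-nearFar far (inj₁ refl) u∈t w∈t)
nearPair-window far _   (inj₂ (inj₁ refl)) (inj₂ (inj₂ refl)) u∈t w∈t =
  ⊥-elim (¬window-nearFar far (inj₂ refl) u∈t w∈t)
nearPair-window far _   (inj₂ (inj₂ refl)) (inj₁ refl)        u∈t w∈t =
  ⊥-elim (¬window-nearFar far (inj₁ refl) w∈t u∈t)
nearPair-window far _   (inj₂ (inj₂ refl)) (inj₂ (inj₁ refl)) u∈t w∈t =
  ⊥-elim (¬window-nearFar far (inj₂ refl) w∈t u∈t)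

module Path (k : ℕ) where

  windowBlock : ℕ → Subset (7 + k)
  windowBlock t = triple t (1 + t) (2 + t)

  initialBlock : Subset (7 + k)
  initialBlock = triple 0 1 (6 + k)

  finalBlock : Subset (7 + k)
  finalBlock = triple 2 (5 + k) (6 + k)

  blocks : List (Subset (7 + k))
  blocks = initialBlock ∷ finalBlock ∷ map windowBlock (upTo (5 + k))

  H : Hypergraph (7 + k)
  H = hypergraph blocks

  data Block : Subset (7 + k) → Set where
    initial : Block initialBlock
    final   : Block finalBlock
    window  : ∀ {t} → t < 5 + k → Block (windowBlock t)

  block : ∀ {e} → e ∈ blocks → Block e
  block (here refl)         = initial
  block (there (here refl)) = final
  block (there (there e∈)) with t , t∈ , refl ← ∈-map⁻ windowBlock e∈ = window (∈-upTo⁻ t∈)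

  initial∈ : initialBlock ∈ blocks
  initial∈ = here refl

  final∈ : finalBlock ∈ blocks
  final∈ = there (here refl)

  window∈ : ∀ {t} → t < 5 + k → windowBlock t ∈ blocks
  window∈ t<5+k = there (there (∈-map⁺ windowBlock (∈-upTo⁺ t<5+k)))

  uniform : ThreeUniform H
  uniform = All.tabulate (∣Block∣≡3 ∘ block)
    where
    ∣Block∣≡3 : ∀ {e} → Block e → ∣ e ∣ ≡ 3
    ∣Block∣≡3 initial          = ∣triple∣≡3 (s≤s z≤n) (s≤s (s≤s z≤n)) ≤-refl
    ∣Block∣≡3 final            = ∣triple∣≡3 (s≤s (s≤s (s≤s z≤n))) ≤-refl ≤-refl
    ∣Block∣≡3 (window t<5+k)   = ∣triple∣≡3 ≤-refl ≤-refl (s≤s (s≤s t<5+k))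

  initial∩final : OneOf u 0 1 (6 + k) → OneOf u 2 (5 + k) (6 + k) → u ≡ 6 + k
  initial∩final (inj₂ (inj₂ refl)) _ = refl
  initial∩final (inj₁ refl)        (inj₁ ())
  initial∩final (inj₁ refl)        (inj₂ (inj₁ ()))
  initial∩final (inj₁ refl)        (inj₂ (inj₂ ()))
  initial∩final (inj₂ (inj₁ refl)) (inj₁ ())
  initial∩final (inj₂ (inj₁ refl)) (inj₂ (inj₁ ()))
  initial∩final (inj₂ (inj₁ refl)) (inj₂ (inj₂ ()))

  initial-far : 4 + 0 ≤ 6 + k ⊎ 3 + (6 + k) ≤ 0
  initial-far = inj₁ (s≤s (s≤s (s≤s (s≤s z≤n))))

  final-far : 4 + (5 + k) ≤ 2 ⊎ 3 + 2 ≤ 5 + k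
  final-far = inj₂ (s≤s (s≤s (s≤s (s≤s (s≤s z≤n)))))

  consecutive : ∀ {e₁ e₂} → Block e₁ → Block e₂ → e₁ ≢ e₂ → x ≢ y →
                x ∈ˢ e₁ ∩ e₂ → y ∈ˢ e₁ ∩ e₂ → Consecutive (toℕ x) (toℕ y)
  consecutive initial initial e₁≢e₂ _ _ _ = contradiction refl e₁≢e₂
  consecutive final   final   e₁≢e₂ _ _ _ = contradiction refl e₁≢e₂
  consecutive initial final   _ x≢y x∈ y∈ = contradiction
    (trans (initial∩final (∈ˡ-triple⁻ x∈) (∈ʳ-triple⁻ x∈))
           (sym (initial∩final (∈ˡ-triple⁻ y∈) (∈ʳ-triple⁻ y∈))))
    (x≢y ∘ toℕ-injective)
  consecutive final   initial _ x≢y x∈ y∈ = contradiction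
    (trans (initial∩final (∈ʳ-triple⁻ x∈) (∈ˡ-triple⁻ x∈))
           (sym (initial∩final (∈ʳ-triple⁻ y∈) (∈ˡ-triple⁻ y∈))))
    (x≢y ∘ toℕ-injective)
  consecutive initial (window _) _ x≢y x∈ y∈ = nearPair-window initial-far (x≢y ∘ toℕ-injective)
    (∈ˡ-triple⁻ x∈) (∈ˡ-triple⁻ y∈) (∈ʳ-triple⁻ x∈) (∈ʳ-triple⁻ y∈)
  consecutive (window _) initial _ x≢y x∈ y∈ = nearPair-window initial-far (x≢y ∘ toℕ-injective)
    (∈ʳ-triple⁻ x∈) (∈ʳ-triple⁻ y∈) (∈ˡ-triple⁻ x∈) (∈ˡ-triple⁻ y∈)
  consecutive final (window _) _ x≢y x∈ y∈ = nearPair-window final-far (x≢y ∘ toℕ-injective)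
    (OneOf-rotate (∈ˡ-triple⁻ x∈)) (OneOf-rotate (∈ˡ-triple⁻ y∈)) (∈ʳ-triple⁻ x∈) (∈ʳ-triple⁻ y∈)
  consecutive (window _) final _ x≢y x∈ y∈ = nearPair-window final-far (x≢y ∘ toℕ-injective)
    (OneOf-rotate (∈ʳ-triple⁻ x∈)) (OneOf-rotate (∈ʳ-triple⁻ y∈)) (∈ˡ-triple⁻ x∈) (∈ˡ-triple⁻ y∈)
  consecutive (window _) (window _) e₁≢e₂ x≢y x∈ y∈ = windows-consecutive (e₁≢e₂ ∘ cong windowBlock)
    (∈ˡ-triple⁻ x∈) (∈ˡ-triple⁻ y∈) (∈ʳ-triple⁻ x∈) (∈ʳ-triple⁻ y∈) (x≢y ∘ toℕ-injective)

  initial≢firstWindow : initialBlock ≢ windowBlock 0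
  initial≢firstWindow = triple≢ ≤-refl (inj₂ (inj₂ refl)) λ { (inj₁ ()) ; (inj₂ (inj₁ ())) ; (inj₂ (inj₂ ())) }

  window≢nextWindow : ∀ {t} → t < 5 + k → windowBlock t ≢ windowBlock (1 + t)
  window≢nextWindow t<5+k =
    triple≢ (≤-trans t<5+k (m≤n+m _ 2)) (inj₁ refl) λ { (inj₁ ()) ; (inj₂ (inj₁ ())) ; (inj₂ (inj₂ ())) }

  lastWindow≢final : windowBlock (4 + k) ≢ finalBlock
  lastWindow≢final = triple≢ (m≤n+m _ 2) (inj₁ refl) λ { (inj₁ ()) ; (inj₂ (inj₁ ())) ; (inj₂ (inj₂ ())) }

  pathEdgeShared : ∀ {i j : Fin (7 + k)} ℓ → toℕ i ≡ ℓ → toℕ j ≡ suc ℓ → ℓ ≤ 5 + k → SharedPair H i j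
  pathEdgeShared zero i≡ℓ j≡1+ℓ _ =
    sharedByTriples initial∈ (window∈ (s≤s z≤n)) initial≢firstWindow
      i≡ℓ j≡1+ℓ (inj₁ refl) (inj₁ refl) (inj₂ (inj₁ refl)) (inj₂ (inj₁ refl))
  pathEdgeShared (suc t) i≡ℓ j≡1+ℓ 1+t≤5+k with m≤n⇒m<n∨m≡n 1+t≤5+k
  ... | inj₁ 1+t<5+k =
    sharedByTriples (window∈ t<5+k) (window∈ 1+t<5+k) (window≢nextWindow t<5+k)
      i≡ℓ j≡1+ℓ (inj₂ (inj₁ refl)) (inj₁ refl) (inj₂ (inj₂ refl)) (inj₂ (inj₁ refl))
    where t<5+k = ≤-trans (n≤1+n _) 1+t<5+k
  ... | inj₂ refl =
    sharedByTriples (window∈ ≤-refl) final∈ lastWindow≢final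
      i≡ℓ j≡1+ℓ (inj₂ (inj₁ refl)) (inj₂ (inj₁ refl)) (inj₂ (inj₂ refl)) (inj₂ (inj₂ refl))

  isEI3 : IsEI3 (PathEdge (7 + k))
  isEI3 = H , uniform , isEdgeIntersectionOf uniform edge⇒shared shared⇒edge
    where
    edge⇒shared : ∀ {S} → PathEdge (7 + k) S → ∃₂ λ x y → x ≢ y × S ≡ ⁅ x ⁆ ∪ ⁅ y ⁆ × SharedPair H x y
    edge⇒shared (i , j , j≡1+i , refl) =
      i , j , (λ { refl → 1+n≢n (sym j≡1+i) }) , refl ,
      pathEdgeShared (toℕ i) refl j≡1+i (≤-pred (≤-pred (subst (_< 7 + k) j≡1+i (toℕ<n j))))
    shared⇒edge : ∀ {x y} → x ≢ y → SharedPair H x y → PathEdge (7 + k) (⁅ x ⁆ ∪ ⁅ y ⁆)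
    shared⇒edge x≢y (shared e₁∈ e₂∈ e₁≢e₂ x∈ y∈) =
      consecutive⇒PathEdge (consecutive (block e₁∈) (block e₂∈) e₁≢e₂ x≢y x∈ y∈)

pathOfOneVertex : IsEI3 (PathEdge 1)
pathOfOneVertex = hypergraph [] , All.[] , λ S → mk⇔ (λ { (zero , zero , () , _) }) λ { (_ , _ , () , _) }

lemma1 : ((n : ℕ) → 3 ≤ n → IsEI3 (StarEdge n))
       × ((n : ℕ) → (n ≡ 1 ⊎ 7 ≤ n) → IsEI3 (PathEdge n))
lemma1 = star , path
  where
  star : (n : ℕ) → 3 ≤ n → IsEI3 (StarEdge n)
  star (suc (suc (suc k))) (s≤s (s≤s (s≤s _))) = Star.isEI3 k
  path : (n : ℕ) → (n ≡ 1 ⊎ 7 ≤ n) → IsEI3 (PathEdge n)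
  path _ (inj₁ refl) = pathOfOneVertex
  path (suc (suc (suc (suc (suc (suc (suc k))))))) (inj₂ (s≤s (s≤s (s≤s (s≤s (s≤s (s≤s (s≤s _)))))))) =
    Path.isEI3 k
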